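{- Let $n$ be a positive integer with $n \mid \sigma(n)$ (a multiperfect number), and write its prime factorization as $n=\prod_{i=1}^{r} p_i^{e_i}$ with distinct primes $p_i$ and exponents $e_i\ge 1$. Let $L=\operatorname{lcm}(e_1+1,\dots,e_r+1)$. If $L$ is a prime number, then $n=6$.
   Context: $\sigma(n)$ denotes the sum of the positive divisors of the positive integer $n$. -}

module Defs where

open import Data.Nat.Base using (ℕ; suc; _+_; _*_; _^_; _≤_)
open import Relation.Binary.PropositionalEquality using (_≡_)
open import Data.Nat.Divisibility using (_∣?_)
open import Data.Nat.LCM using (lcm)
open import Data.Nat.ListAction using (sum; product)
open import Data.Nat.Primality using (Prime)
open import Data.List.Base using (List; map; filter; applyUpTo; foldr)
open import Data.List.Relation.Unary.All using (All)
open import Data.List.Relation.Unary.Unique.Propositional using (Unique)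
open import Data.Product.Base using (_×_; _,_; proj₁; proj₂)

σ : ℕ → ℕ
σ n = sum (filter (_∣? n) (applyUpTo suc n))

Factorisation : Set
Factorisation = List (ℕ × ℕ)

IsPrimeFactorisation : ℕ → Factorisation → Set
IsPrimeFactorisation n fs =
  All (λ pe → Prime (proj₁ pe)) fs ×
  All (λ pe → 1 ≤ proj₂ pe) fs ×
  Unique (map proj₁ fs) ×
  n ≡ product (map (λ pe → proj₁ pe ^ proj₂ pe) fs)

lcmList : List ℕ → ℕ
lcmList = foldr lcm 1

Lof : Factorisation → ℕ
Lof fs = lcmList (map (λ pe → proj₂ pe + 1) fs)

module Submission where

-- Every exponent e of n has e + 1 ∣ L, so when L = q is prime all exponents equal q − 1 and
-- σ(n) = ∏ (1 + p + ⋯ + p^(q−1)) = k·n.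
--
-- q = 2: the largest prime M ∣ n divides p + 1 for some prime p ∣ n with p ≤ M, so M = p + 1,
-- which forces p = 2, M = 3 and n = 6.
--
-- q odd: σ(n) is odd, hence n and k are odd and k ≥ 3. A prime l dividing 1 + a + ⋯ + a^(q−1)
-- has l = q or q ∣ l − 1 (the order of a modulo l divides both q and l − 1), so the s primes of
-- n other than q are ≡ 1 (mod 2q) and q^s ∣ σ(n) = k·n. This is incompatible with the
-- bound k < ∏ p/(p − 1). If q ∤ n, then q^s ∣ k and p ≤ q(p − 1) already contradict it. If q ∣ n,
-- it becomes k(q − 1)(2q)^s < q(2q + 1)^s, contradicting k ≥ 3 when s ≤ q, because
-- (1 + 1/(2q))^q ≤ 2, and k ≥ q^(s−q+1) when s > q.

open import Defs
open import Data.Nat.Base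
open import Data.Nat.Properties
open import Data.Nat.Divisibility
open import Data.Nat.Primality
open import Data.Nat.Coprimality as Coprime using (Coprime; coprime-Bézout; coprime-divisor)
open import Data.Nat.GCD using (module Bézout)
open import Data.Nat.LCM using (m∣lcm[m,n]; n∣lcm[m,n])
open import Data.Nat.Combinatorics using (_C_; nCn≡1; nC1≡n; k>n⇒nCk≡0; nCk+nC[k+1]≡[n+1]C[k+1])
open import Data.Nat.Tactic.RingSolver using (solve-∀)
open import Algebra.Properties.CommutativeSemigroup *-commutativeSemigroup using (interchange; x∙yz≈y∙xz)
open import Data.Nat.ListAction using (sum; product)
open import Data.Nat.ListAction.Properties using (sum-++; sum-↭; product-↭; product≢0)
open import Data.List.Base using (List; []; _∷_; map; filter; applyUpTo; _++_; length)
open import Data.List.Relation.Unary.All as All using (All; []; _∷_)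
import Data.List.Relation.Unary.All.Properties as All
open import Data.List.Relation.Unary.AllPairs using ([]; _∷_)
open import Data.List.Relation.Unary.Any using (here; there)
open import Data.List.Relation.Unary.Unique.Propositional using (Unique)
import Data.List.Relation.Unary.Unique.Propositional.Properties as Unique
open import Data.List.Membership.Propositional using (_∈_; _∉_)
open import Data.List.Membership.Propositional.Properties
open import Data.List.Relation.Binary.Subset.Propositional using (_⊆_)
open import Data.List.Relation.Binary.Permutation.Propositional
  using (_↭_; ↭-refl; ↭-sym; ↭-trans; prep; ↭⇒↭ₛ)
import Data.List.Relation.Binary.Permutation.Setoid.Properties as Permutationₛ
import Data.List.Relation.Binary.Permutation.Propositional.Properties as Permutation
open import Data.Product.Base using (_×_; _,_; proj₁; proj₂; ∃; ∃₂)
open import Data.Sum.Base using (_⊎_; inj₁; inj₂)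
open import Data.Empty using (⊥; ⊥-elim)
open import Function.Base using (_∘_)
open import Relation.Nullary using (¬_; yes; no)
import Data.List.Extrema.Nat as Extrema
open import Data.List.Membership.DecPropositional _≟_ using (_∈?_)
open import Relation.Binary.Bundles using (Setoid)
open import Relation.Binary.Structures using (IsEquivalence)
open import Relation.Binary.PropositionalEquality
import Relation.Binary.Reasoning.Setoid as SetoidReasoning

prime>1 : ∀ {p} → Prime p → 1 < p
prime>1 {p} pp = nonTrivial⇒n>1 p {{prime⇒nonTrivial pp}}

prime∤1 : ∀ {p} → Prime p → ¬ p ∣ 1
prime∤1 pp p∣1 = nonTrivial⇒≢1 {{prime⇒nonTrivial pp}} (∣1⇒≡1 p∣1)

prime∣prime⇒≡ : ∀ {p q} → Prime p → Prime q → p ∣ q → p ≡ q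
prime∣prime⇒≡ pp pq p∣q with prime⇒irreducible pq p∣q
... | inj₁ p≡1 = ⊥-elim (nonTrivial⇒≢1 {{prime⇒nonTrivial pp}} p≡1)
... | inj₂ p≡q = p≡q

prime∣^⇒∣ : ∀ {p a} → Prime p → ∀ n → p ∣ a ^ n → p ∣ a
prime∣^⇒∣ pp zero    p∣1 = ⊥-elim (prime∤1 pp p∣1)
prime∣^⇒∣ {a = a} pp (suc n) p∣aⁿ⁺¹ with euclidsLemma a (a ^ n) pp p∣aⁿ⁺¹
... | inj₁ p∣a  = p∣a
... | inj₂ p∣aⁿ = prime∣^⇒∣ pp n p∣aⁿ

prime∤⇒coprime : ∀ {p n} → Prime p → ¬ p ∣ n → Coprime p n
prime∤⇒coprime pp p∤n (d∣p , d∣n) with prime⇒irreducible pp d∣p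
... | inj₁ d≡1 = d≡1
... | inj₂ refl = ⊥-elim (p∤n d∣n)

2∣n⊎2∣1+n : ∀ n → 2 ∣ n ⊎ 2 ∣ suc n
2∣n⊎2∣1+n zero    = inj₁ (divides 0 refl)
2∣n⊎2∣1+n (suc n) with 2∣n⊎2∣1+n n
... | inj₁ (divides c refl) = inj₂ (divides (suc c) refl)
... | inj₂ 2∣1+n           = inj₁ 2∣1+n

2∣n*[1+n] : ∀ n → 2 ∣ n * suc n
2∣n*[1+n] n with 2∣n⊎2∣1+n n
... | inj₁ 2∣n   = ∣m⇒∣m*n (suc n) 2∣n
... | inj₂ 2∣1+n = ∣n⇒∣m*n n 2∣1+n

consecutive-primes : ∀ {p} → Prime p → Prime (suc p) → p ≡ 2
consecutive-primes {p} pp p+1-prime with 2∣n⊎2∣1+n p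
... | inj₁ 2∣p   = sym (prime∣prime⇒≡ prime[2] pp 2∣p)
... | inj₂ 2∣1+p with refl ← prime∣prime⇒≡ prime[2] p+1-prime 2∣1+p =
  ⊥-elim (<-irrefl refl (prime>1 pp))

-- Congruences

infix 4 _≡_mod_

_≡_mod_ : ℕ → ℕ → ℕ → Set
a ≡ b mod m = ∃₂ λ u v → a + u * m ≡ b + v * m

module _ {m : ℕ} where

  mod-reflexive : ∀ {a b} → a ≡ b → a ≡ b mod m
  mod-reflexive refl = 0 , 0 , refl

  mod-refl : ∀ {a} → a ≡ a mod m
  mod-refl = mod-reflexive refl

  mod-sym : ∀ {a b} → a ≡ b mod m → b ≡ a mod m
  mod-sym (u , v , eq) = v , u , sym eq

  mod-trans : ∀ {a b c} → a ≡ b mod m → b ≡ c mod m → a ≡ c mod m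
  mod-trans {a} {b} {c} (u , v , eq₁) (u′ , v′ , eq₂) = u + u′ , v′ + v , (begin
    a + (u + u′) * m      ≡⟨ shuffle a u u′ m ⟩
    (a + u * m) + u′ * m  ≡⟨ cong (_+ u′ * m) eq₁ ⟩
    (b + v * m) + u′ * m  ≡⟨ shuffle′ b v u′ m ⟩
    (b + u′ * m) + v * m  ≡⟨ cong (_+ v * m) eq₂ ⟩
    (c + v′ * m) + v * m  ≡⟨ shuffle c v′ v m ⟨
    c + (v′ + v) * m      ∎)
    where
    open ≡-Reasoning
    shuffle : ∀ a u u′ m → a + (u + u′) * m ≡ (a + u * m) + u′ * m
    shuffle = solve-∀
    shuffle′ : ∀ b v u′ m → (b + v * m) + u′ * m ≡ (b + u′ * m) + v * m
    shuffle′ = solve-∀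

  mod-isEquivalence : IsEquivalence (λ a b → a ≡ b mod m)
  mod-isEquivalence = record { refl = mod-refl ; sym = mod-sym ; trans = mod-trans }

  mod-+ : ∀ {a b c d} → a ≡ b mod m → c ≡ d mod m → a + c ≡ b + d mod m
  mod-+ {a} {b} {c} {d} (u , v , eq₁) (u′ , v′ , eq₂) = u + u′ , v + v′ , (begin
    (a + c) + (u + u′) * m      ≡⟨ shuffle a c u u′ m ⟩
    (a + u * m) + (c + u′ * m)  ≡⟨ cong₂ _+_ eq₁ eq₂ ⟩
    (b + v * m) + (d + v′ * m)  ≡⟨ shuffle b d v v′ m ⟨
    (b + d) + (v + v′) * m      ∎)
    where
    open ≡-Reasoning
    shuffle : ∀ a c u u′ m → (a + c) + (u + u′) * m ≡ (a + u * m) + (c + u′ * m)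
    shuffle = solve-∀

  mod-*ʳ : ∀ {a b} c → a ≡ b mod m → a * c ≡ b * c mod m
  mod-*ʳ {a} {b} c (u , v , eq) = u * c , v * c , (begin
    a * c + (u * c) * m  ≡⟨ distrib a u c m ⟩
    (a + u * m) * c      ≡⟨ cong (_* c) eq ⟩
    (b + v * m) * c      ≡⟨ distrib b v c m ⟨
    b * c + (v * c) * m  ∎)
    where
    open ≡-Reasoning
    distrib : ∀ a u c m → a * c + (u * c) * m ≡ (a + u * m) * c
    distrib = solve-∀

  mod-*ˡ : ∀ {a b} c → a ≡ b mod m → c * a ≡ c * b mod m
  mod-*ˡ {a} {b} c rewrite *-comm c a | *-comm c b = mod-*ʳ c

  mod-* : ∀ {a b c d} → a ≡ b mod m → c ≡ d mod m → a * c ≡ b * d mod m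
  mod-* {b = b} {c = c} a≡b c≡d = mod-trans (mod-*ʳ c a≡b) (mod-*ˡ b c≡d)

  mod-^ : ∀ {a b} n → a ≡ b mod m → a ^ n ≡ b ^ n mod m
  mod-^ zero    _   = mod-refl
  mod-^ (suc n) a≡b = mod-* a≡b (mod-^ n a≡b)

  +-multiple-mod : ∀ a k → a + k * m ≡ a mod m
  +-multiple-mod a k = 0 , k , +-identityʳ _

  ∣⇒≡0-mod : ∀ {a} → m ∣ a → a ≡ 0 mod m
  ∣⇒≡0-mod {a} (divides k eq) = 0 , k , trans (+-identityʳ a) eq

  ≡0-mod⇒∣ : ∀ {a} → a ≡ 0 mod m → m ∣ a
  ≡0-mod⇒∣ {a} (u , v , eq) = ∣m+n∣m⇒∣n (divides v (trans (+-comm (u * m) a) eq)) (n∣m*n u)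

  mod-cancelˡ-+ : ∀ c {x y} → c + x ≡ c + y mod m → x ≡ y mod m
  mod-cancelˡ-+ c {x} {y} (u , v , eq) =
    u , v , +-cancelˡ-≡ c _ _ (trans (sym (+-assoc c x _)) (trans eq (+-assoc c y _)))

mod-setoid : ℕ → Setoid _ _
mod-setoid m = record { isEquivalence = mod-isEquivalence {m} }

module ≡-mod-Reasoning (m : ℕ) = SetoidReasoning (mod-setoid m)

x≡x+d⇒∣ : ∀ {m} x {d} → x ≡ x + d mod m → m ∣ d
x≡x+d⇒∣ x x≡x+d =
  ≡0-mod⇒∣ (mod-sym (mod-cancelˡ-+ x (mod-trans (mod-reflexive (+-identityʳ x)) x≡x+d)))

≡1-mod⇒∤ : ∀ {m a} → 1 < m → a ≡ 1 mod m → ¬ m ∣ a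
≡1-mod⇒∤ m>1 a≡1 m∣a =
  <⇒≢ m>1 (sym (∣1⇒≡1 (≡0-mod⇒∣ (mod-trans (mod-sym a≡1) (∣⇒≡0-mod m∣a)))))

private
  mod-cancelˡ-*-≤ : ∀ {p a x y} → Prime p → ¬ p ∣ a → x ≤ y →
    a * x ≡ a * y mod p → x ≡ y mod p
  mod-cancelˡ-*-≤ {p} {a} {x} pp p∤a x≤y ax≡ay with d , refl ← m≤n⇒∃[o]m+o≡n x≤y =
    mod-sym (mod-trans (mod-+ (mod-refl {a = x}) (∣⇒≡0-mod p∣d)) (mod-reflexive (+-identityʳ x)))
    where
    p∣ad : p ∣ a * d
    p∣ad = x≡x+d⇒∣ (a * x) (mod-trans ax≡ay (mod-reflexive (*-distribˡ-+ a x d)))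
    p∣d : p ∣ d
    p∣d with euclidsLemma a d pp p∣ad
    ... | inj₁ p∣a = ⊥-elim (p∤a p∣a)
    ... | inj₂ p∣d = p∣d

mod-cancelˡ-* : ∀ {p a x y} → Prime p → ¬ p ∣ a → a * x ≡ a * y mod p → x ≡ y mod p
mod-cancelˡ-* {x = x} {y} pp p∤a ax≡ay with ≤-total x y
... | inj₁ x≤y = mod-cancelˡ-*-≤ pp p∤a x≤y ax≡ay
... | inj₂ y≤x = mod-sym (mod-cancelˡ-*-≤ pp p∤a y≤x (mod-sym ax≡ay))

-- Fermat's little theorem

binomialSum : ℕ → ℕ → ℕ → ℕ
binomialSum n x zero    = 0
binomialSum n x (suc k) = binomialSum n x k + (n C k) * x ^ k

pascal : ∀ n k → suc n C suc k ≡ n C k + n C suc k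
pascal n k = sym (nCk+nC[k+1]≡[n+1]C[k+1] n k)

binomialSum-suc : ∀ n x k →
  binomialSum (suc n) x (suc k) ≡ (x + 1) * binomialSum n x k + (n C k) * x ^ k
binomialSum-suc n x zero    rewrite *-zeroʳ (x + 1) = refl
binomialSum-suc n x (suc k) rewrite binomialSum-suc n x k | pascal n k =
  regroup x (binomialSum n x k) (n C k) (n C suc k) (x ^ k)
  where
  regroup : ∀ x B c c′ X →
    (x + 1) * B + c * X + (c + c′) * (x * X) ≡ (x + 1) * (B + c * X) + c′ * (x * X)
  regroup = solve-∀

binomial-theorem : ∀ n x → (x + 1) ^ n ≡ binomialSum n x (suc n)
binomial-theorem zero    x = refl
binomial-theorem (suc n) x = begin
  (x + 1) * (x + 1) ^ n                             ≡⟨ cong ((x + 1) *_) (binomial-theorem n x) ⟩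
  (x + 1) * S                                       ≡⟨ +-identityʳ _ ⟨
  (x + 1) * S + 0 * x ^ suc n                       ≡⟨ cong (λ c → (x + 1) * S + c * x ^ suc n) (k>n⇒nCk≡0 (n<1+n n)) ⟨
  (x + 1) * S + (n C suc n) * x ^ suc n             ≡⟨ binomialSum-suc n x (suc n) ⟨
  binomialSum (suc n) x (suc (suc n))               ∎
  where
  open ≡-Reasoning
  S : ℕ
  S = binomialSum n x (suc n)

absorption : ∀ n k → suc k * (suc n C suc k) ≡ suc n * (n C k)
absorption zero    zero    = refl
absorption zero    (suc k) = *-zeroʳ (suc (suc k))
absorption (suc n) zero    = trans (*-identityˡ _) (trans (nC1≡n (suc (suc n))) (sym (*-identityʳ _)))
absorption (suc n) (suc k) = begin
  suc (suc k) * (suc (suc n) C suc (suc k))     ≡⟨ cong (suc (suc k) *_) (pascal (suc n) (suc k)) ⟩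
  suc (suc k) * (A + B)                         ≡⟨ *-distribˡ-+ (suc (suc k)) A B ⟩
  A + suc k * A + suc (suc k) * B               ≡⟨ cong₂ (λ u v → A + u + v) (absorption n k) (absorption n (suc k)) ⟩
  A + suc n * a + suc n * b                     ≡⟨ cong (λ A → A + suc n * a + suc n * b) (pascal n k) ⟩
  (a + b) + suc n * a + suc n * b               ≡⟨ regroup n a b ⟩
  suc (suc n) * (a + b)                         ≡⟨ cong (suc (suc n) *_) (pascal n k) ⟨
  suc (suc n) * A                               ∎
  where
  open ≡-Reasoning
  A B a b : ℕ
  A = suc n C suc k
  B = suc n C suc (suc k)
  a = n C k
  b = n C suc k
  regroup : ∀ n a b → (a + b) + suc n * a + suc n * b ≡ suc (suc n) * (a + b)
  regroup = solve-∀

prime∣C : ∀ {p k} → Prime p → 0 < k → k < p → p ∣ p C k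
prime∣C {suc n} {suc k} pp _ k<p
  with euclidsLemma (suc k) (suc n C suc k) pp (divides (n C k) (trans (absorption n k) (*-comm (suc n) _)))
... | inj₁ p∣k = ⊥-elim (<⇒≱ k<p (∣⇒≤ p∣k))
... | inj₂ p∣C = p∣C

binomialSum-prime≡1 : ∀ {p} → Prime p → ∀ x k → suc k ≤ p → binomialSum p x (suc k) ≡ 1 mod p
binomialSum-prime≡1 pp x zero    _   = mod-refl
binomialSum-prime≡1 pp x (suc k) k<p =
  mod-+ (binomialSum-prime≡1 pp x k (<⇒≤ k<p))
        (∣⇒≡0-mod (∣m⇒∣m*n (x ^ suc k) (prime∣C pp (s≤s z≤n) k<p)))

fermat : ∀ {p} → Prime p → ∀ x → x ^ p ≡ x mod p
fermat {suc n} pp zero = mod-refl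
fermat {p@(suc n)} pp (suc x) = begin
  suc x ^ p                             ≡⟨ cong (_^ p) (+-comm 1 x) ⟩
  (x + 1) ^ p                           ≡⟨ binomial-theorem p x ⟩
  binomialSum p x p + (p C p) * x ^ p   ≈⟨ mod-+ (binomialSum-prime≡1 pp x n ≤-refl) mod-refl ⟩
  1 + (p C p) * x ^ p                   ≡⟨ cong (λ c → 1 + c * x ^ p) (nCn≡1 p) ⟩
  1 + 1 * x ^ p                         ≡⟨ cong suc (*-identityˡ (x ^ p)) ⟩
  1 + x ^ p                             ≈⟨ mod-+ mod-refl (fermat pp x) ⟩
  suc x                                 ∎
  where open ≡-mod-Reasoning p

fermat-unit : ∀ {p a} → Prime p → ¬ p ∣ a → a ^ (p ∸ 1) ≡ 1 mod p
fermat-unit {suc n} {a} pp p∤a =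
  mod-cancelˡ-* pp p∤a (mod-trans (fermat pp a) (mod-reflexive (sym (*-identityʳ a))))

-- Geometric sums

geomSum : ℕ → ℕ → ℕ
geomSum a zero    = 0
geomSum a (suc m) = geomSum a m + a ^ m

geomSum-sucˡ : ∀ a m → geomSum a (suc m) ≡ 1 + a * geomSum a m
geomSum-sucˡ a zero    rewrite *-zeroʳ a = refl
geomSum-sucˡ a (suc m) =
  trans (cong (_+ a ^ suc m) (geomSum-sucˡ a m)) (regroup a (geomSum a m) (a ^ m))
  where
  regroup : ∀ a G X → 1 + a * G + a * X ≡ 1 + a * (G + X)
  regroup = solve-∀

geomSum-2 : ∀ p → geomSum p 2 ≡ suc p
geomSum-2 p = cong suc (*-identityʳ p)

geomSum-closed-form : ∀ a m → 1 + a * geomSum (suc a) m ≡ suc a ^ m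
geomSum-closed-form a m = +-cancelˡ-≡ G _ _ (begin
  G + (1 + a * G)        ≡⟨ regroup G a ⟩
  1 + suc a * G          ≡⟨ geomSum-sucˡ (suc a) m ⟨
  G + suc a ^ m          ∎)
  where
  open ≡-Reasoning
  G : ℕ
  G = geomSum (suc a) m
  regroup : ∀ G a → G + (1 + a * G) ≡ 1 + (1 + a) * G
  regroup = solve-∀

geomSum*pred<^ : ∀ a m → geomSum (suc a) m * a < suc a ^ m
geomSum*pred<^ a m =
  subst (geomSum (suc a) m * a <_) (geomSum-closed-form a m) (s≤s (≤-reflexive (*-comm _ a)))

^<geomSum : ∀ a e → 1 ≤ e → a ^ e < geomSum a (suc e)
^<geomSum a (suc e) _ = m<n+m (a ^ suc e) (subst (0 <_) (sym (geomSum-sucˡ a e)) (s≤s z≤n))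

geomSum-odd : ∀ a h → geomSum a (suc (h * 2)) ≡ 1 mod 2
geomSum-odd a zero    = mod-refl
geomSum-odd a (suc h) = begin
  geomSum a (suc n) + a ^ suc n + a ^ suc (suc n)    ≡⟨ +-assoc (geomSum a (suc n)) _ _ ⟩
  geomSum a (suc n) + (a ^ suc n + a ^ suc (suc n))  ≈⟨ mod-+ (geomSum-odd a h) (∣⇒≡0-mod 2∣aⁿ⁺¹+aⁿ⁺²) ⟩
  1 + 0                                              ∎
  where
  open ≡-mod-Reasoning 2
  n : ℕ
  n = h * 2
  factor : ∀ a X → a * X + a * (a * X) ≡ X * (a * suc a)
  factor = solve-∀
  2∣aⁿ⁺¹+aⁿ⁺² : 2 ∣ a ^ suc n + a ^ suc (suc n)
  2∣aⁿ⁺¹+aⁿ⁺² = subst (2 ∣_) (sym (factor a (a ^ n))) (∣n⇒∣m*n (a ^ n) (2∣n*[1+n] a))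

geomSum-≡1 : ∀ {l a} → a ≡ 1 mod l → ∀ m → geomSum a m ≡ m mod l
geomSum-≡1 a≡1 zero    = mod-refl
geomSum-≡1 a≡1 (suc m) = mod-trans
  (mod-+ (geomSum-≡1 a≡1 m) (mod-trans (mod-^ m a≡1) (mod-reflexive (^-zeroˡ m))))
  (mod-reflexive (+-comm m 1))

∣pred⇒∣geomSum : ∀ {q} p → q ∣ p → q ∣ geomSum (suc p) q
∣pred⇒∣geomSum {q} p (divides c refl) =
  ≡0-mod⇒∣ (mod-trans (geomSum-≡1 (+-multiple-mod 1 c) q) (∣⇒≡0-mod ∣-refl))

∣geomSum⇒^≡1 : ∀ {l a} m → l ∣ geomSum a m → a ^ m ≡ 1 mod l
∣geomSum⇒^≡1 {l} {a} m l∣G = begin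
  a ^ m                  ≈⟨ mod-+ (mod-sym (∣⇒≡0-mod l∣G)) mod-refl ⟩
  geomSum a m + a ^ m    ≡⟨ geomSum-sucˡ a m ⟩
  1 + a * geomSum a m    ≈⟨ mod-+ mod-refl (mod-*ˡ a (∣⇒≡0-mod l∣G)) ⟩
  1 + a * 0              ≡⟨ cong suc (*-zeroʳ a) ⟩
  1                      ∎
  where open ≡-mod-Reasoning l

prime∣geomSum⇒∤ : ∀ {l a} m → Prime l → l ∣ geomSum a (suc m) → ¬ l ∣ a
prime∣geomSum⇒∤ {l} {a} m pl l∣G l∣a =
  prime∤1 pl (∣m+n∣m⇒∣n (subst (l ∣_) (trans (geomSum-sucˡ a m) (+-comm 1 _)) l∣G)
                        (∣m⇒∣m*n _ l∣a))

private
  bezout-step : ∀ {m a} i j x y → a ^ i ≡ 1 mod m → a ^ j ≡ 1 mod m →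
    1 + y * j ≡ x * i → a ≡ 1 mod m
  bezout-step {m} {a} i j x y aⁱ≡1 aʲ≡1 eq = begin
    a                  ≡⟨ *-identityʳ a ⟨
    a * 1              ≡⟨ cong (a *_) (^-zeroˡ y) ⟨
    a * 1 ^ y          ≈⟨ mod-*ˡ a (mod-^ y (mod-sym aʲ≡1)) ⟩
    a * (a ^ j) ^ y    ≡⟨ cong (a *_) (^-*-assoc a j y) ⟩
    a ^ (1 + j * y)    ≡⟨ cong (λ e → a ^ (1 + e)) (*-comm j y) ⟩
    a ^ (1 + y * j)    ≡⟨ cong (a ^_) eq ⟩
    a ^ (x * i)        ≡⟨ cong (a ^_) (*-comm x i) ⟩
    a ^ (i * x)        ≡⟨ ^-*-assoc a i x ⟨
    (a ^ i) ^ x        ≈⟨ mod-^ x aⁱ≡1 ⟩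
    1 ^ x              ≡⟨ ^-zeroˡ x ⟩
    1                  ∎
    where open ≡-mod-Reasoning m

^≡1-coprime⇒≡1 : ∀ {m a i j} → a ^ i ≡ 1 mod m → a ^ j ≡ 1 mod m → Coprime i j → a ≡ 1 mod m
^≡1-coprime⇒≡1 {i = i} {j} aⁱ≡1 aʲ≡1 i⊥j with coprime-Bézout i⊥j
... | Bézout.+- x y eq = bezout-step i j x y aⁱ≡1 aʲ≡1 eq
... | Bézout.-+ x y eq = bezout-step j i y x aʲ≡1 aⁱ≡1 eq

prime∣geomSum : ∀ {l q} a → Prime l → Prime q → l ∣ geomSum a q → l ≡ q ⊎ q ∣ l ∸ 1
prime∣geomSum {l@(suc l′)} {q@(suc q′)} a pl pq l∣G with q ∣? l′
... | yes q∣l′ = inj₂ q∣l′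
... | no  q∤l′ =
  inj₁ (prime∣prime⇒≡ pl pq (≡0-mod⇒∣ (mod-trans (mod-sym (geomSum-≡1 a≡1 q)) (∣⇒≡0-mod l∣G))))
  where
  a≡1 : a ≡ 1 mod l
  a≡1 = ^≡1-coprime⇒≡1 (∣geomSum⇒^≡1 q l∣G) (fermat-unit pl (prime∣geomSum⇒∤ q′ pl l∣G))
                       (prime∤⇒coprime pq q∤l′)

module _ {A : Set} where

  unique-extract : ∀ {x : A} {xs} → x ∈ xs → Unique xs →
    ∃ λ ys → xs ↭ x ∷ ys × Unique (x ∷ ys)
  unique-extract {x} x∈xs !xs with ys , zs , refl ← ∈-∃++ x∈xs =
    ys ++ zs , xs↭x∷ys , Permutationₛ.Unique-resp-↭ (setoid A) (↭⇒↭ₛ xs↭x∷ys) !xs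
    where
    xs↭x∷ys : ys ++ x ∷ zs ↭ x ∷ ys ++ zs
    xs↭x∷ys = Permutation.shift x ys zs

  unique-⊆-⊇⇒↭ : ∀ {xs ys : List A} → Unique xs → Unique ys → xs ⊆ ys → ys ⊆ xs → xs ↭ ys
  unique-⊆-⊇⇒↭ {[]}     {[]}    _ _ _ _ = ↭-refl
  unique-⊆-⊇⇒↭ {[]}     {_ ∷ _} _ _ _ ys⊆xs with () ← ys⊆xs (here refl)
  unique-⊆-⊇⇒↭ {x ∷ xs} (x∉xs ∷ !xs) !ys xs⊆ys ys⊆xs
    with zs , ys↭x∷zs , (x∉zs ∷ !zs) ← unique-extract (xs⊆ys (here refl)) !ys =
    ↭-trans (prep x (unique-⊆-⊇⇒↭ !xs !zs xs⊆zs zs⊆xs)) (↭-sym ys↭x∷zs)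
    where
    xs⊆zs : xs ⊆ zs
    xs⊆zs z∈xs with Permutation.∈-resp-↭ ys↭x∷zs (xs⊆ys (there z∈xs))
    ... | here refl  = ⊥-elim (All.lookup x∉xs z∈xs refl)
    ... | there z∈zs = z∈zs
    zs⊆xs : zs ⊆ xs
    zs⊆xs z∈zs with ys⊆xs (Permutation.∈-resp-↭ (↭-sym ys↭x∷zs) (there z∈zs))
    ... | here refl  = ⊥-elim (All.lookup x∉zs z∈zs refl)
    ... | there z∈xs = z∈xs

∃-maximum : ∀ xs → xs ≢ [] → ∃ λ M → M ∈ xs × All (_≤ M) xs
∃-maximum []       xs≢[] = ⊥-elim (xs≢[] refl)
∃-maximum (x ∷ xs) _     = Extrema.max x xs
  , Extrema.argmax-all (λ x → x) {P = _∈ x ∷ xs} (here refl) (All.tabulate there)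
  , Extrema.v≤max⁺ x xs (inj₁ ≤-refl) ∷ Extrema.xs≤max x xs

Π : (ℕ → ℕ) → List ℕ → ℕ
Π f xs = product (map f xs)

Π-* : ∀ f g xs → Π (λ x → f x * g x) xs ≡ Π f xs * Π g xs
Π-* f g []       = refl
Π-* f g (x ∷ xs) = trans (cong (f x * g x *_) (Π-* f g xs)) (interchange (f x) (g x) (Π f xs) (Π g xs))

Π-const : ∀ c xs → Π (λ _ → c) xs ≡ c ^ length xs
Π-const c []       = refl
Π-const c (x ∷ xs) = cong (c *_) (Π-const c xs)

Π-↭ : ∀ f {xs ys} → xs ↭ ys → Π f xs ≡ Π f ys
Π-↭ f xs↭ys = product-↭ (Permutation.map⁺ f xs↭ys)

Π-mono-≤ : ∀ f g xs → (∀ {x} → x ∈ xs → f x ≤ g x) → Π f xs ≤ Π g xs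
Π-mono-≤ f g []       f≤g = ≤-refl
Π-mono-≤ f g (x ∷ xs) f≤g = *-mono-≤ (f≤g (here refl)) (Π-mono-≤ f g xs (f≤g ∘ there))

Π-mono-< : ∀ f g xs → xs ≢ [] → (∀ {x} → x ∈ xs → f x < g x) → Π f xs < Π g xs
Π-mono-< f g []           xs≢[] f<g = ⊥-elim (xs≢[] refl)
Π-mono-< f g (x ∷ [])     _     f<g = *-monoˡ-< 1 (f<g (here refl))
Π-mono-< f g (x ∷ y ∷ xs) _     f<g =
  *-mono-< (f<g (here refl)) (Π-mono-< f g (y ∷ xs) (λ ()) (f<g ∘ there))

∈⇒∣Π : ∀ f {x xs} → x ∈ xs → f x ∣ Π f xs
∈⇒∣Π f {xs = x ∷ xs} (here refl) = m∣m*n (Π f xs)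
∈⇒∣Π f {xs = y ∷ xs} (there x∈)  = ∣-trans (∈⇒∣Π f x∈) (n∣m*n (f y))

∈⇒∣k*Π^ : ∀ {p xs} k e → p ∈ xs → p ∣ k * Π (_^ suc e) xs
∈⇒∣k*Π^ {p} k e p∈xs = ∣-trans (∣-trans (m∣m*n (p ^ e)) (∈⇒∣Π (_^ suc e) p∈xs)) (n∣m*n k)

^length∣Π : ∀ {d} f xs → (∀ {x} → x ∈ xs → d ∣ f x) → d ^ length xs ∣ Π f xs
^length∣Π f []       d∣f = ∣-refl
^length∣Π f (x ∷ xs) d∣f = *-pres-∣ (d∣f (here refl)) (^length∣Π f xs (d∣f ∘ there))

prime∣Π⇒∃ : ∀ {l} f xs → Prime l → l ∣ Π f xs → ∃ λ x → x ∈ xs × l ∣ f x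
prime∣Π⇒∃ f []       pl l∣1 = ⊥-elim (prime∤1 pl l∣1)
prime∣Π⇒∃ f (x ∷ xs) pl l∣Π with euclidsLemma (f x) (Π f xs) pl l∣Π
... | inj₁ l∣fx = x , here refl , l∣fx
... | inj₂ l∣Πf with y , y∈ , l∣fy ← prime∣Π⇒∃ f xs pl l∣Πf = y , there y∈ , l∣fy

Π-≡1 : ∀ {m} f xs → (∀ {x} → x ∈ xs → f x ≡ 1 mod m) → Π f xs ≡ 1 mod m
Π-≡1 f []       f≡1 = mod-refl
Π-≡1 f (x ∷ xs) f≡1 = mod-* (f≡1 (here refl)) (Π-≡1 f xs (f≡1 ∘ there))

prime∉⇒∤Π^ : ∀ {l} e xs → Prime l → All Prime xs → l ∉ xs → ¬ l ∣ Π (_^ e) xs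
prime∉⇒∤Π^ e xs pl xs-prime l∉xs l∣Π with x , x∈xs , l∣xᵉ ← prime∣Π⇒∃ (_^ e) xs pl l∣Π =
  l∉xs (subst (_∈ xs) (sym (prime∣prime⇒≡ pl (All.lookup xs-prime x∈xs) (prime∣^⇒∣ pl e l∣xᵉ)))
              x∈xs)

^∣*∧∤⇒^∣ : ∀ {q m} → Prime q → ¬ q ∣ m → ∀ a x → q ^ a ∣ x * m → q ^ a ∣ x
^∣*∧∤⇒^∣ pq q∤m zero    x _ = 1∣ x
^∣*∧∤⇒^∣ {q} {m} pq q∤m (suc a) x qᵃ⁺¹∣xm
  with euclidsLemma x m pq (∣-trans (m∣m*n (q ^ a)) qᵃ⁺¹∣xm)
... | inj₂ q∣m = ⊥-elim (q∤m q∣m)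
... | inj₁ (divides c refl) = subst (q * q ^ a ∣_) (*-comm q c) (*-monoʳ-∣ q qᵃ∣c)
  where
  instance
    q≢0 : NonZero q
    q≢0 = prime⇒nonZero pq
  reassoc : ∀ c q m → c * q * m ≡ q * (c * m)
  reassoc = solve-∀
  qᵃ∣c : q ^ a ∣ c
  qᵃ∣c = ^∣*∧∤⇒^∣ pq q∤m a c (*-cancelˡ-∣ q (subst (q * q ^ a ∣_) (reassoc c q m) qᵃ⁺¹∣xm))

-- The divisor sum of a product of prime powers

sum-map-*ˡ : ∀ c xs → sum (map (c *_) xs) ≡ c * sum xs
sum-map-*ˡ c []       = sym (*-zeroʳ c)
sum-map-*ˡ c (x ∷ xs) = trans (cong (c * x +_) (sum-map-*ˡ c xs)) (sym (*-distribˡ-+ c x (sum xs)))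

divisors : ℕ → List ℕ
divisors n = filter (_∣? n) (applyUpTo suc n)

divisors-unique : ∀ n → Unique (divisors n)
divisors-unique n =
  Unique.filter⁺ (_∣? n) (Unique.applyUpTo⁺₁ suc n (λ i<j _ → <⇒≢ i<j ∘ suc-injective))

∈-divisors⁻ : ∀ {c} n → c ∈ divisors n → c ∣ n
∈-divisors⁻ n c∈ = proj₂ (∈-filter⁻ (_∣? n) {xs = applyUpTo suc n} c∈)

∈-divisors⁺ : ∀ {c} n .{{_ : NonZero n}} → c ∣ n → c ∈ divisors n
∈-divisors⁺ {zero}  n c∣n = ⊥-elim (≢-nonZero⁻¹ n (0∣⇒≡0 c∣n))
∈-divisors⁺ {suc c} n c∣n = ∈-filter⁺ (_∣? n) (∈-applyUpTo⁺ suc (∣⇒≤ c∣n)) c∣n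

∣p^[1+e]*n⇒∣p^e*n : ∀ {p c n} e → Prime p →
  c ∣ p ^ suc e * n → ¬ p ^ suc e ∣ c → c ∣ p ^ e * n
∣p^[1+e]*n⇒∣p^e*n {p} {c} {n} e pp c∣ p^[1+e]∤c with p ∣? c
... | no p∤c =
  coprime-divisor (Coprime.sym (prime∤⇒coprime pp p∤c)) (subst (c ∣_) (*-assoc p (p ^ e) n) c∣)
∣p^[1+e]*n⇒∣p^e*n {p} {n = n} zero pp c∣ p^1∤c | yes (divides c′ refl) =
  ⊥-elim (p^1∤c (subst (_∣ c′ * p) (sym (*-identityʳ p)) (n∣m*n c′)))
∣p^[1+e]*n⇒∣p^e*n {p} {n = n} (suc e) pp c∣ p^[2+e]∤c | yes (divides c′ refl) =
  subst₂ _∣_ (*-comm p c′) (sym (*-assoc p (p ^ e) n)) (*-monoʳ-∣ p c′∣p^e*n)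
  where
  instance
    p≢0 : NonZero p
    p≢0 = prime⇒nonZero pp
  c′∣p^[1+e]*n : c′ ∣ p ^ suc e * n
  c′∣p^[1+e]*n = *-cancelˡ-∣ p (subst₂ _∣_ (*-comm c′ p) (*-assoc p (p ^ suc e) n) c∣)
  p^[1+e]∤c′ : ¬ p ^ suc e ∣ c′
  p^[1+e]∤c′ p^[1+e]∣c′ =
    p^[2+e]∤c (subst (p ^ suc (suc e) ∣_) (*-comm p c′) (*-monoʳ-∣ p p^[1+e]∣c′))
  c′∣p^e*n : c′ ∣ p ^ e * n
  c′∣p^e*n = ∣p^[1+e]*n⇒∣p^e*n e pp c′∣p^[1+e]*n p^[1+e]∤c′

module _ {p m} (pp : Prime p) (p∤m : ¬ p ∣ m) .{{_ : NonZero m}} where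

  divisors-p^[1+e]*m↭ : ∀ e →
    divisors (p ^ suc e * m) ↭ divisors (p ^ e * m) ++ map (p ^ suc e *_) (divisors m)
  divisors-p^[1+e]*m↭ e = unique-⊆-⊇⇒↭ (divisors-unique N) !rhs ⊆rhs rhs⊆
    where
    P N N′ : ℕ
    P  = p ^ suc e
    N  = P * m
    N′ = p ^ e * m
    p≢0 : NonZero p
    p≢0 = prime⇒nonZero pp
    instance
      P≢0 : NonZero P
      P≢0 = m^n≢0 p (suc e) {{p≢0}}
      N≢0 : NonZero N
      N≢0 = m*n≢0 P m
      N′≢0 : NonZero N′
      N′≢0 = m*n≢0 (p ^ e) m {{m^n≢0 p e {{p≢0}}}}
    N≡p*N′ : N ≡ p * N′
    N≡p*N′ = *-assoc p (p ^ e) m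
    disjoint : ∀ {v} → ¬ (v ∈ divisors N′ × v ∈ map (P *_) (divisors m))
    disjoint (v∈ , v∈map) with c , _ , refl ← ∈-map⁻ (P *_) v∈map =
      p∤m (∣-trans (m∣m*n c) (*-cancelˡ-∣ (p ^ e) {{m^n≢0 p e {{p≢0}}}}
        (subst (_∣ N′) (reassoc p (p ^ e) c) (∈-divisors⁻ N′ v∈))))
      where
      reassoc : ∀ p P c → p * P * c ≡ P * (p * c)
      reassoc = solve-∀
    !rhs : Unique (divisors N′ ++ map (P *_) (divisors m))
    !rhs = Unique.++⁺ (divisors-unique N′) (Unique.map⁺ (*-cancelˡ-≡ _ _ P) (divisors-unique m)) disjoint
    ⊆rhs : divisors N ⊆ divisors N′ ++ map (P *_) (divisors m)
    ⊆rhs {c} c∈ with P ∣? c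
    ... | no  P∤c = ∈-++⁺ˡ (∈-divisors⁺ N′ (∣p^[1+e]*n⇒∣p^e*n e pp (∈-divisors⁻ N c∈) P∤c))
    ... | yes (divides c′ refl) =
      ∈-++⁺ʳ _ (subst (_∈ map (P *_) (divisors m)) (*-comm P c′) (∈-map⁺ (P *_) (∈-divisors⁺ m c′∣m)))
      where
      c′∣m : c′ ∣ m
      c′∣m = *-cancelˡ-∣ P (subst (_∣ N) (*-comm c′ P) (∈-divisors⁻ N c∈))
    rhs⊆ : divisors N′ ++ map (P *_) (divisors m) ⊆ divisors N
    rhs⊆ {c} c∈ with ∈-++⁻ (divisors N′) c∈
    ... | inj₁ c∈ˡ = ∈-divisors⁺ N (subst (c ∣_) (sym N≡p*N′) (∣-trans (∈-divisors⁻ N′ c∈ˡ) (n∣m*n p)))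
    ... | inj₂ c∈ʳ with c′ , c′∈ , refl ← ∈-map⁻ (P *_) c∈ʳ = ∈-divisors⁺ N (*-monoʳ-∣ P (∈-divisors⁻ m c′∈))

  σ-p^e*m : ∀ e → σ (p ^ e * m) ≡ geomSum p (suc e) * σ m
  σ-p^e*m zero    = trans (cong σ (*-identityˡ m)) (sym (*-identityˡ (σ m)))
  σ-p^e*m (suc e) = begin
    σ (p ^ suc e * m)                                              ≡⟨ sum-↭ (divisors-p^[1+e]*m↭ e) ⟩
    sum (divisors (p ^ e * m) ++ map (p ^ suc e *_) (divisors m))  ≡⟨ sum-++ (divisors (p ^ e * m)) _ ⟩
    σ (p ^ e * m) + sum (map (p ^ suc e *_) (divisors m))          ≡⟨ cong₂ _+_ (σ-p^e*m e) (sum-map-*ˡ (p ^ suc e) (divisors m)) ⟩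
    geomSum p (suc e) * σ m + p ^ suc e * σ m                      ≡⟨ *-distribʳ-+ (σ m) (geomSum p (suc e)) (p ^ suc e) ⟨
    geomSum p (suc (suc e)) * σ m                                  ∎
    where open ≡-Reasoning

σ-Π : ∀ e ps → All Prime ps → Unique ps → σ (Π (_^ e) ps) ≡ Π (λ p → geomSum p (suc e)) ps
σ-Π e []       _                _              = refl
σ-Π e (p ∷ ps) (pp ∷ ps-prime) (p∉ps ∷ !ps) =
  trans (σ-p^e*m pp p∤Π {{Π≢0}} e) (cong (geomSum p (suc e) *_) (σ-Π e ps ps-prime !ps))
  where
  p∤Π : ¬ p ∣ Π (_^ e) ps
  p∤Π = prime∉⇒∤Π^ e ps pp ps-prime (λ p∈ps → All.lookup p∉ps p∈ps refl)
  Π≢0 : NonZero (Π (_^ e) ps)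
  Π≢0 = product≢0 (All.map⁺ (All.map (λ pp → m^n≢0 _ e {{prime⇒nonZero pp}}) ps-prime))

2≤⇒≤*pred : ∀ {m n} → 2 ≤ m → 2 ≤ n → n ≤ m * (n ∸ 1)
2≤⇒≤*pred {n = 1} _ (s≤s ())
2≤⇒≤*pred {m} {suc (suc n)} m≥2 _ = ≤-trans 2+n≤2[1+n] (*-monoˡ-≤ (suc n) m≥2)
  where
  2+n≤2[1+n] : 2 + n ≤ 2 * suc n
  2+n≤2[1+n] = s≤s (subst (suc n ≤_) (sym (+-suc n (n + 0))) (s≤s (m≤m+n n (n + 0))))

<⇒*≤suc*pred : ∀ {c p} → c < p → p * c ≤ suc c * (p ∸ 1)
<⇒*≤suc*pred {c} {suc p} (s≤s c≤p) =
  subst (suc p * c ≤_) (cong (p +_) (*-comm p c)) (+-monoˡ-≤ (p * c) c≤p)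

∣pred∧odd⇒2*< : ∀ {p q} → 1 < p → ¬ 2 ∣ p → 2 ∣ suc q → q ∣ p ∸ 1 → 2 * q < p
∣pred∧odd⇒2*< {suc _} (s≤s ()) _ _ (divides zero refl)
∣pred∧odd⇒2*< {suc _} {q} _ p-odd 2∣1+q (divides (suc zero) refl) =
  ⊥-elim (p-odd (subst (λ n → 2 ∣ suc n) (sym (+-identityʳ q)) 2∣1+q))
∣pred∧odd⇒2*< {suc _} {q} _ _ _ (divides (suc (suc c)) refl) = s≤s (+-monoʳ-≤ q (+-monoʳ-≤ q z≤n))

odd∧*≡∧<⇒3≤ : ∀ {k x y} → ¬ 2 ∣ k → k * x ≡ y → x < y → 3 ≤ k
odd∧*≡∧<⇒3≤ {0} _ refl x<0 = ⊥-elim (n≮0 x<0)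
odd∧*≡∧<⇒3≤ {1} {x} _ refl x<x+0 = ⊥-elim (<-irrefl (sym (+-identityʳ x)) x<x+0)
odd∧*≡∧<⇒3≤ {2} 2∤2 _ _ = ⊥-elim (2∤2 ∣-refl)
odd∧*≡∧<⇒3≤ {suc (suc (suc _))} _ _ _ = s≤s (s≤s (s≤s z≤n))

-- (1 + 1/n)^s ≤ n/(n − s) for s ≤ n, written with n = s + d.
reverse-bernoulli : ∀ s d → suc (s + d) ^ s * d ≤ (s + d) ^ suc s
reverse-bernoulli zero    d = ≤-reflexive (trans (*-identityˡ d) (sym (*-identityʳ d)))
reverse-bernoulli (suc s) d = begin
  suc n ^ suc s * d        ≡⟨ regroup₁ (suc n) (suc n ^ s) d ⟩
  suc n ^ s * (suc n * d)  ≤⟨ *-monoʳ-≤ (suc n ^ s) [1+n]d≤n[1+d] ⟩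
  suc n ^ s * (n * suc d)  ≡⟨ regroup₂ (suc n ^ s) n (suc d) ⟩
  n * (suc n ^ s * suc d)  ≤⟨ *-monoʳ-≤ n induction ⟩
  n * n ^ suc s            ∎
  where
  open ≤-Reasoning
  n : ℕ
  n = suc (s + d)
  regroup₁ : ∀ x y d → x * y * d ≡ y * (x * d)
  regroup₁ = solve-∀
  regroup₂ : ∀ y n d → y * (n * d) ≡ n * (y * d)
  regroup₂ = solve-∀
  induction : suc n ^ s * suc d ≤ n ^ suc s
  induction = subst (λ n → suc n ^ s * suc d ≤ n ^ suc s) (+-suc s d) (reverse-bernoulli s (suc d))
  [1+n]d≤n[1+d] : suc n * d ≤ n * suc d
  [1+n]d≤n[1+d] = subst (suc n * d ≤_) (sym (*-suc n d)) (+-monoˡ-≤ (n * d) (≤-trans (m≤n+m d s) (n≤1+n _)))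

[1+2q]^s≤2[2q]^s : ∀ q s .{{_ : NonZero q}} → s ≤ q → suc (2 * q) ^ s ≤ 2 * (2 * q) ^ s
[1+2q]^s≤2[2q]^s q s s≤q = *-cancelʳ-≤ _ _ q (begin
  suc (2 * q) ^ s * q    ≤⟨ *-monoʳ-≤ (suc (2 * q) ^ s) q≤d ⟩
  suc (2 * q) ^ s * d    ≡⟨ cong (λ n → suc n ^ s * d) s+d≡2q ⟨
  suc (s + d) ^ s * d    ≤⟨ reverse-bernoulli s d ⟩
  (s + d) ^ suc s        ≡⟨ cong (_^ suc s) s+d≡2q ⟩
  2 * q * (2 * q) ^ s    ≡⟨ regroup q ((2 * q) ^ s) ⟩
  2 * (2 * q) ^ s * q    ∎)
  where
  open ≤-Reasoning
  d : ℕ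
  d = 2 * q ∸ s
  s+d≡2q : s + d ≡ 2 * q
  s+d≡2q = m+[n∸m]≡n (≤-trans s≤q (m≤m+n q (q + 0)))
  q≤d : q ≤ d
  q≤d = subst (_≤ d) (trans (m+n∸m≡n q (q + 0)) (+-identityʳ q)) (∸-monoʳ-≤ (2 * q) s≤q)
  regroup : ∀ q X → 2 * q * X ≡ 2 * X * q
  regroup = solve-∀

^-mono-≤-* : ∀ {a b c} n → a ≤ b * c → a ^ n ≤ b ^ n * c ^ n
^-mono-≤-* zero    _      = ≤-refl
^-mono-≤-* {a} {b} {c} (suc n) a≤bc =
  ≤-trans (*-mono-≤ a≤bc (^-mono-≤-* n a≤bc)) (≤-reflexive (interchange b c (b ^ n) (c ^ n)))

[1+2q]^[q+1+t]≤2q^[1+t][2q]^[q+1+t] : ∀ q t → 2 ≤ q →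
  suc (2 * q) ^ (q + suc t) ≤ 2 * q ^ suc t * (2 * q) ^ (q + suc t)
[1+2q]^[q+1+t]≤2q^[1+t][2q]^[q+1+t] q t q≥2 = begin
  suc (2 * q) ^ (q + suc t)                            ≡⟨ ^-distribˡ-+-* (suc (2 * q)) q (suc t) ⟩
  suc (2 * q) ^ q * suc (2 * q) ^ suc t                ≤⟨ *-mono-≤ ([1+2q]^s≤2[2q]^s q q {{>-nonZero (<⇒≤ q≥2)}} ≤-refl)
                                                                   (^-mono-≤-* {b = q} {2 * q} (suc t) 1+2q≤q*2q) ⟩
  2 * (2 * q) ^ q * (q ^ suc t * (2 * q) ^ suc t)      ≡⟨ regroup 2 ((2 * q) ^ q) (q ^ suc t) ((2 * q) ^ suc t) ⟩
  2 * q ^ suc t * ((2 * q) ^ q * (2 * q) ^ suc t)      ≡⟨ cong (2 * q ^ suc t *_) (^-distribˡ-+-* (2 * q) q (suc t)) ⟨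
  2 * q ^ suc t * (2 * q) ^ (q + suc t)                ∎
  where
  open ≤-Reasoning
  regroup : ∀ a x y z → a * x * (y * z) ≡ a * y * (x * z)
  regroup = solve-∀
  1+2q≤q*2q : suc (2 * q) ≤ q * (2 * q)
  1+2q≤q*2q = ≤-trans (m<m+n (2 * q) 0<2q+0) (*-monoˡ-≤ (2 * q) q≥2)
    where
    0<2q+0 : 0 < 2 * q + 0
    0<2q+0 = ≤-trans (≤-trans (<⇒≤ q≥2) (m≤m+n q (q + 0))) (m≤m+n (2 * q) 0)

even-exponent-bound : ∀ e k s → 2 ≤ e → 3 ≤ k → (∀ t → suc e + t ≡ s → suc e ^ suc t ≤ k) →
  suc e * suc (2 * suc e) ^ s ≤ k * e * (2 * suc e) ^ s
even-exponent-bound e k s e≥2 k≥3 qᵗ⁺¹≤k with s ≤? suc e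
... | yes s≤q = begin
  q * suc (2 * q) ^ s    ≤⟨ *-monoʳ-≤ q ([1+2q]^s≤2[2q]^s q s s≤q) ⟩
  q * (2 * W)            ≡⟨ regroup q W ⟩
  2 * q * W              ≤⟨ *-monoˡ-≤ W 2q≤ke ⟩
  k * e * W              ∎
  where
  open ≤-Reasoning
  q : ℕ
  q = suc e
  W : ℕ
  W = (2 * q) ^ s
  regroup : ∀ q W → q * (2 * W) ≡ 2 * q * W
  regroup = solve-∀
  2q≤ke : 2 * q ≤ k * e
  2q≤ke = ≤-trans (subst (_≤ 3 * e) (sym (*-suc 2 e)) (+-monoˡ-≤ (2 * e) e≥2)) (*-monoˡ-≤ e k≥3)
... | no  s≰q with t , 1+q+t≡s ← m≤n⇒∃[o]m+o≡n (≰⇒> s≰q) rewrite sym (trans (+-suc (suc e) t) 1+q+t≡s) = begin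
  q * suc (2 * q) ^ (q + suc t)            ≤⟨ *-monoʳ-≤ q ([1+2q]^[q+1+t]≤2q^[1+t][2q]^[q+1+t] q t (s≤s (<⇒≤ e≥2))) ⟩
  q * (2 * q ^ suc t * W)                  ≡⟨ regroup q (q ^ suc t) W ⟩
  q ^ suc (suc t) * 2 * W                  ≤⟨ *-monoˡ-≤ W (*-mono-≤ (qᵗ⁺¹≤k (suc t) refl) e≥2) ⟩
  k * e * W                                ∎
  where
  open ≤-Reasoning
  q : ℕ
  q = suc e
  W : ℕ
  W = (2 * q) ^ (q + suc t)
  regroup : ∀ q Q W → q * (2 * Q * W) ≡ q * Q * 2 * W
  regroup = solve-∀

-- Exponent one

∣1+n∧n≤⇒≡1+n : ∀ {m n} → 1 < m → n ≤ m → m ∣ suc n → m ≡ suc n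
∣1+n∧n≤⇒≡1+n {m} {n} m>1 n≤m m∣1+n with m≤n⇒m<n∨m≡n n≤m
... | inj₁ n<m  = ≤-antisym (∣⇒≤ m∣1+n) n<m
... | inj₂ refl =
  ⊥-elim (<⇒≢ m>1 (sym (∣1⇒≡1 (∣m+n∣m⇒∣n (subst (m ∣_) (+-comm 1 m) m∣1+n) ∣-refl))))

2≤∧≤3⇒∈[2,3] : ∀ {p} → 2 ≤ p → p ≤ 3 → p ∈ 2 ∷ 3 ∷ []
2≤∧≤3⇒∈[2,3] {1} (s≤s ()) _
2≤∧≤3⇒∈[2,3] {2} _ _ = here refl
2≤∧≤3⇒∈[2,3] {3} _ _ = there (here refl)
2≤∧≤3⇒∈[2,3] {suc (suc (suc (suc _)))} _ (s≤s (s≤s (s≤s ())))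

squarefree-multiperfect : ∀ ps k → All Prime ps → Unique ps → ps ≢ [] →
  k * Π (_^ 1) ps ≡ Π (λ p → geomSum p 2) ps → ps ↭ 2 ∷ 3 ∷ []
squarefree-multiperfect ps k ps-prime !ps ps≢[] eq
  with M , M∈ps , ps≤M ← ∃-maximum ps ps≢[]
  with p , p∈ps , M∣G ← prime∣Π⇒∃ (λ p → geomSum p 2) ps (All.lookup ps-prime M∈ps)
                                   (subst (M ∣_) eq (∈⇒∣k*Π^ k 0 M∈ps))
  with refl ← ∣1+n∧n≤⇒≡1+n (prime>1 (All.lookup ps-prime M∈ps)) (All.lookup ps≤M p∈ps)
                           (subst (M ∣_) (geomSum-2 p) M∣G)
  with refl ← consecutive-primes (All.lookup ps-prime p∈ps) (All.lookup ps-prime M∈ps)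
  = unique-⊆-⊇⇒↭ !ps (((λ ()) ∷ []) ∷ [] ∷ [])
      (λ q∈ps → 2≤∧≤3⇒∈[2,3] (prime>1 (All.lookup ps-prime q∈ps)) (All.lookup ps≤M q∈ps))
      (λ { (here refl) → p∈ps ; (there (here refl)) → M∈ps })

-- Even exponent

module EvenExponent (h k : ℕ) (ps : List ℕ) (q-prime : Prime (suc (suc h * 2)))
  (ps-prime : All Prime ps) (!ps : Unique ps) (ps≢[] : ps ≢ [])
  (σ≡kn : k * Π (_^ (suc h * 2)) ps ≡ Π (λ p → geomSum p (suc (suc h * 2))) ps) where

  e : ℕ
  e = suc h * 2

  q : ℕ
  q = suc e

  e≥2 : 2 ≤ e
  e≥2 = s≤s (s≤s z≤n)

  ∈⇒∣σ : ∀ {p} → p ∈ ps → p ∣ Π (λ p → geomSum p q) ps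
  ∈⇒∣σ p∈ps = subst (_ ∣_) σ≡kn (∈⇒∣k*Π^ k (suc (h * 2)) p∈ps)

  σ-odd : Π (λ p → geomSum p q) ps ≡ 1 mod 2
  σ-odd = Π-≡1 _ ps (λ {p} _ → geomSum-odd p (suc h))

  ps-odd : ∀ {p} → p ∈ ps → ¬ 2 ∣ p
  ps-odd p∈ps 2∣p = ≡1-mod⇒∤ (s≤s (s≤s z≤n)) σ-odd (∣-trans 2∣p (∈⇒∣σ p∈ps))

  k≥3 : 3 ≤ k
  k≥3 = odd∧*≡∧<⇒3≤ k-odd σ≡kn (Π-mono-< _ _ ps ps≢[] (λ {p} _ → ^<geomSum p e (s≤s z≤n)))
    where
    k-odd : ¬ 2 ∣ k
    k-odd 2∣k = ≡1-mod⇒∤ (s≤s (s≤s z≤n)) σ-odd (subst (2 ∣_) σ≡kn (∣m⇒∣m*n _ 2∣k))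

  instance
    k≢0 : NonZero k
    k≢0 = >-nonZero (≤-trans (s≤s z≤n) k≥3)

  ≡q⊎q∣pred : ∀ {p} → p ∈ ps → p ≡ q ⊎ q ∣ p ∸ 1
  ≡q⊎q∣pred p∈ps with p′ , _ , p∣σ[p′] ← prime∣Π⇒∃ _ ps (All.lookup ps-prime p∈ps) (∈⇒∣σ p∈ps) =
    prime∣geomSum p′ (All.lookup ps-prime p∈ps) q-prime p∣σ[p′]

  q∣σ[p] : ∀ {p} → Prime p → q ∣ p ∸ 1 → q ∣ geomSum p q
  q∣σ[p] {zero}  pp _ with () ← prime>1 pp
  q∣σ[p] {suc p} _  q∣p = ∣pred⇒∣geomSum p q∣p

  abundancy : k * Π (_∸ 1) ps < Π (λ p → p) ps
  abundancy = *-cancelˡ-< (Π (_^ e) ps) _ _ (begin-strict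
    Π (_^ e) ps * (k * Π (_∸ 1) ps)          ≡⟨ regroup (Π (_^ e) ps) k (Π (_∸ 1) ps) ⟩
    k * Π (_^ e) ps * Π (_∸ 1) ps            ≡⟨ cong (_* Π (_∸ 1) ps) σ≡kn ⟩
    Π (λ p → geomSum p q) ps * Π (_∸ 1) ps   ≡⟨ Π-* (λ p → geomSum p q) (_∸ 1) ps ⟨
    Π (λ p → geomSum p q * (p ∸ 1)) ps       <⟨ Π-mono-< _ _ ps ps≢[] (σ[p]*pred<p^q ∘ All.lookup ps-prime) ⟩
    Π (λ p → p ^ e * p) ps                   ≡⟨ Π-* (_^ e) (λ p → p) ps ⟩
    Π (_^ e) ps * Π (λ p → p) ps             ∎)
    where
    open ≤-Reasoning
    regroup : ∀ F k D → F * (k * D) ≡ k * F * D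
    regroup = solve-∀
    σ[p]*pred<p^q : ∀ {p} → Prime p → geomSum p q * (p ∸ 1) < p ^ e * p
    σ[p]*pred<p^q {zero}  pp with () ← prime>1 pp
    σ[p]*pred<p^q {suc p} _  = subst (geomSum (suc p) q * p <_) (*-comm (suc p) (suc p ^ e)) (geomSum*pred<^ p q)

  q∉ps⇒⊥ : q ∉ ps → ⊥
  q∉ps⇒⊥ q∉ps = <-irrefl refl (≤-<-trans Πp≤kΠ[p-1] abundancy)
    where
    open ≤-Reasoning
    q∣p-1 : ∀ {p} → p ∈ ps → q ∣ p ∸ 1
    q∣p-1 p∈ps with ≡q⊎q∣pred p∈ps
    ... | inj₁ refl = ⊥-elim (q∉ps p∈ps)
    ... | inj₂ q∣p-1 = q∣p-1
    qˢ∣k : q ^ length ps ∣ k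
    qˢ∣k = ^∣*∧∤⇒^∣ q-prime (prime∉⇒∤Π^ e ps q-prime ps-prime q∉ps) (length ps) k
      (subst (q ^ length ps ∣_) (sym σ≡kn)
        (^length∣Π _ ps (λ p∈ps → q∣σ[p] (All.lookup ps-prime p∈ps) (q∣p-1 p∈ps))))
    Πp≤kΠ[p-1] : Π (λ p → p) ps ≤ k * Π (_∸ 1) ps
    Πp≤kΠ[p-1] = begin
      Π (λ p → p) ps                      ≤⟨ Π-mono-≤ _ _ ps (2≤⇒≤*pred (prime>1 q-prime) ∘ prime>1 ∘ All.lookup ps-prime) ⟩
      Π (λ p → q * (p ∸ 1)) ps            ≡⟨ Π-* (λ _ → q) (_∸ 1) ps ⟩
      Π (λ _ → q) ps * Π (_∸ 1) ps        ≡⟨ cong (_* Π (_∸ 1) ps) (Π-const q ps) ⟩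
      q ^ length ps * Π (_∸ 1) ps         ≤⟨ *-monoˡ-≤ (Π (_∸ 1) ps) (∣⇒≤ qˢ∣k) ⟩
      k * Π (_∸ 1) ps                     ∎

  module _ (ps′ : List ℕ) (ps↭q∷ps′ : ps ↭ q ∷ ps′) (q∉ps′ : q ∉ ps′) where

    private
      s : ℕ
      s = length ps′

    ps′⊆ps : ps′ ⊆ ps
    ps′⊆ps = Permutation.∈-resp-↭ (↭-sym ps↭q∷ps′) ∘ there

    ps′-prime : All Prime ps′
    ps′-prime = All.tabulate (All.lookup ps-prime ∘ ps′⊆ps)

    q∣p-1 : ∀ {p} → p ∈ ps′ → q ∣ p ∸ 1
    q∣p-1 p∈ps′ with ≡q⊎q∣pred (ps′⊆ps p∈ps′)
    ... | inj₁ refl  = ⊥-elim (q∉ps′ p∈ps′)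
    ... | inj₂ q∣p-1 = q∣p-1

    2q<p : ∀ {p} → p ∈ ps′ → 2 * q < p
    2q<p p∈ps′ = ∣pred∧odd⇒2*< (prime>1 (All.lookup ps′-prime p∈ps′)) (ps-odd (ps′⊆ps p∈ps′))
                               (divides (suc (suc h)) refl) (q∣p-1 p∈ps′)

    qᵗ⁺¹≤k : ∀ t → q + t ≡ s → q ^ suc t ≤ k
    qᵗ⁺¹≤k t q+t≡s = ∣⇒≤ (^∣*∧∤⇒^∣ q-prime (prime∉⇒∤Π^ e ps′ q-prime ps′-prime q∉ps′) (suc t) k
      (*-cancelˡ-∣ (q ^ e) {{m^n≢0 q e}} (subst₂ _∣_ qˢ≡qᵉqᵗ⁺¹ σ≡qᵉkn′ qˢ∣σ)))
      where
      qˢ≡qᵉqᵗ⁺¹ : q ^ s ≡ q ^ e * q ^ suc t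
      qˢ≡qᵉqᵗ⁺¹ = trans (cong (q ^_) (trans (sym q+t≡s) (sym (+-suc e t)))) (^-distribˡ-+-* q e (suc t))
      σ≡qᵉkn′ : geomSum q q * Π (λ p → geomSum p q) ps′ ≡ q ^ e * (k * Π (_^ e) ps′)
      σ≡qᵉkn′ = begin
        geomSum q q * Π (λ p → geomSum p q) ps′  ≡⟨ Π-↭ (λ p → geomSum p q) ps↭q∷ps′ ⟨
        Π (λ p → geomSum p q) ps                ≡⟨ σ≡kn ⟨
        k * Π (_^ e) ps                         ≡⟨ cong (k *_) (Π-↭ (_^ e) ps↭q∷ps′) ⟩
        k * (q ^ e * Π (_^ e) ps′)              ≡⟨ x∙yz≈y∙xz k (q ^ e) (Π (_^ e) ps′) ⟩
        q ^ e * (k * Π (_^ e) ps′)              ∎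
        where open ≡-Reasoning
      qˢ∣σ : q ^ s ∣ geomSum q q * Π (λ p → geomSum p q) ps′
      qˢ∣σ = ∣n⇒∣m*n (geomSum q q) (^length∣Π _ ps′ (λ p∈ps′ → q∣σ[p] (All.lookup ps′-prime p∈ps′) (q∣p-1 p∈ps′)))

    abundancy′ : k * (e * Π (_∸ 1) ps′) < q * Π (λ p → p) ps′
    abundancy′ = subst₂ _<_ (cong (k *_) (Π-↭ (_∸ 1) ps↭q∷ps′)) (Π-↭ (λ p → p) ps↭q∷ps′) abundancy

    Πp[2q]ˢ≤[1+2q]ˢΠ[p-1] : Π (λ p → p) ps′ * (2 * q) ^ s ≤ suc (2 * q) ^ s * Π (_∸ 1) ps′
    Πp[2q]ˢ≤[1+2q]ˢΠ[p-1] = begin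
      Π (λ p → p) ps′ * (2 * q) ^ s               ≡⟨ cong (Π (λ p → p) ps′ *_) (Π-const (2 * q) ps′) ⟨
      Π (λ p → p) ps′ * Π (λ _ → 2 * q) ps′       ≡⟨ Π-* (λ p → p) (λ _ → 2 * q) ps′ ⟨
      Π (λ p → p * (2 * q)) ps′                   ≤⟨ Π-mono-≤ _ _ ps′ (<⇒*≤suc*pred ∘ 2q<p) ⟩
      Π (λ p → suc (2 * q) * (p ∸ 1)) ps′         ≡⟨ Π-* (λ _ → suc (2 * q)) (_∸ 1) ps′ ⟩
      Π (λ _ → suc (2 * q)) ps′ * Π (_∸ 1) ps′    ≡⟨ cong (_* Π (_∸ 1) ps′) (Π-const (suc (2 * q)) ps′) ⟩
      suc (2 * q) ^ s * Π (_∸ 1) ps′              ∎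
      where open ≤-Reasoning

    ke[2q]ˢ<q[1+2q]ˢ : k * e * (2 * q) ^ s < q * suc (2 * q) ^ s
    ke[2q]ˢ<q[1+2q]ˢ = *-cancelʳ-< (Π (_∸ 1) ps′) _ _ (begin-strict
      k * e * W * D      ≡⟨ regroup k e W D ⟩
      k * (e * D) * W    <⟨ *-monoˡ-< W abundancy′ ⟩
      q * P * W          ≡⟨ *-assoc q P W ⟩
      q * (P * W)        ≤⟨ *-monoʳ-≤ q Πp[2q]ˢ≤[1+2q]ˢΠ[p-1] ⟩
      q * (Z * D)        ≡⟨ *-assoc q Z D ⟨
      q * Z * D          ∎)
      where
      open ≤-Reasoning
      W : ℕ
      W = (2 * q) ^ s
      Z : ℕ
      Z = suc (2 * q) ^ s
      D : ℕ
      D = Π (_∸ 1) ps′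
      P : ℕ
      P = Π (λ p → p) ps′
      instance
        W≢0 : NonZero W
        W≢0 = m^n≢0 (2 * q) s
      regroup : ∀ k e W D → k * e * W * D ≡ k * (e * D) * W
      regroup = solve-∀

    q∈ps-contradiction : ⊥
    q∈ps-contradiction = <-irrefl refl (≤-<-trans (even-exponent-bound e k s e≥2 k≥3 qᵗ⁺¹≤k) ke[2q]ˢ<q[1+2q]ˢ)

  contradiction : ⊥
  contradiction with q ∈? ps
  ... | no  q∉ps = q∉ps⇒⊥ q∉ps
  ... | yes q∈ps with ps′ , ps↭q∷ps′ , (q∉ps′ ∷ _) ← unique-extract q∈ps !ps =
    q∈ps-contradiction ps′ ps↭q∷ps′ (λ q∈ps′ → All.lookup q∉ps′ q∈ps′ refl)

∈⇒∣lcmList : ∀ {x xs} → x ∈ xs → x ∣ lcmList xs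
∈⇒∣lcmList {xs = x ∷ xs} (here refl) = m∣lcm[m,n] x (lcmList xs)
∈⇒∣lcmList {xs = y ∷ xs} (there x∈) = ∣-trans (∈⇒∣lcmList x∈) (n∣lcm[m,n] y (lcmList xs))

lcmList-prime⇒≡ : ∀ {x xs} → Prime (lcmList xs) → x ∈ xs → 1 < x → x ≡ lcmList xs
lcmList-prime⇒≡ L-prime x∈xs x>1 with prime⇒irreducible L-prime (∈⇒∣lcmList x∈xs)
... | inj₁ refl = ⊥-elim (<-irrefl refl x>1)
... | inj₂ x≡L  = x≡L

equal-exponents : ∀ {L} fs → All (λ pe → proj₂ pe + 1 ≡ L) fs →
  product (map (λ pe → proj₁ pe ^ proj₂ pe) fs) ≡ Π (_^ (L ∸ 1)) (map proj₁ fs)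
equal-exponents []             []          = refl
equal-exponents ((p , e) ∷ fs) (e+1≡L ∷ ≡L) =
  cong₂ _*_ (cong (p ^_) (trans (sym (m+n∸n≡m e 1)) (cong (_∸ 1) e+1≡L))) (equal-exponents fs ≡L)

prime-Lof⇒≡Π : ∀ {n fs} → IsPrimeFactorisation n fs → Prime (Lof fs) →
  n ≡ Π (_^ (Lof fs ∸ 1)) (map proj₁ fs)
prime-Lof⇒≡Π {fs = fs} (_ , e≥1 , _ , n≡Πpᵉ) L-prime = trans n≡Πpᵉ (equal-exponents fs exponents≡L)
  where
  exponents≡L : All (λ pe → proj₂ pe + 1 ≡ Lof fs) fs
  exponents≡L = All.tabulate λ pe∈fs →
    lcmList-prime⇒≡ L-prime (∈-map⁺ (λ pe → proj₂ pe + 1) pe∈fs) (+-monoˡ-≤ 1 (All.lookup e≥1 pe∈fs))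

prime-exponent-multiperfect : ∀ e k ps → Prime (suc e) → All Prime ps → Unique ps → ps ≢ [] →
  k * Π (_^ e) ps ≡ Π (λ p → geomSum p (suc e)) ps → Π (_^ e) ps ≡ 6
prime-exponent-multiperfect e k ps q-prime ps-prime !ps ps≢[] σ≡kn with 2∣n⊎2∣1+n e
... | inj₂ 2∣1+e with refl ← prime∣prime⇒≡ prime[2] q-prime 2∣1+e =
  Π-↭ (_^ 1) (squarefree-multiperfect ps k ps-prime !ps ps≢[] σ≡kn)
... | inj₁ (divides zero    refl) = ⊥-elim (<-irrefl refl (prime>1 q-prime))
... | inj₁ (divides (suc h) refl) = ⊥-elim (EvenExponent.contradiction h k ps q-prime ps-prime !ps ps≢[] σ≡kn)

mainTheorem2 : (n : ℕ) → 1 ≤ n → n ∣ σ n → (fs : Factorisation) →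
    IsPrimeFactorisation n fs → Prime (Lof fs) → n ≡ 6
mainTheorem2 n _ _ [] _ L-prime = ⊥-elim (<-irrefl refl (prime>1 L-prime))
mainTheorem2 n _ (divides k σn≡kn) fs@(_ ∷ _) n-factorisation@(ps-prime , _ , !ps , _) L-prime =
  trans n≡Π (prime-exponent-multiperfect e k ps q-prime (All.map⁺ ps-prime) !ps (λ ()) σ≡kΠ)
  where
  e : ℕ
  e = Lof fs ∸ 1
  ps : List ℕ
  ps = map proj₁ fs
  q-prime : Prime (suc e)
  q-prime = subst Prime (sym (m+[n∸m]≡n (<⇒≤ (prime>1 L-prime)))) L-prime
  n≡Π : n ≡ Π (_^ e) ps
  n≡Π = prime-Lof⇒≡Π n-factorisation L-prime
  σ≡kΠ : k * Π (_^ e) ps ≡ Π (λ p → geomSum p (suc e)) ps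
  σ≡kΠ = begin
    k * Π (_^ e) ps                  ≡⟨ cong (k *_) n≡Π ⟨
    k * n                            ≡⟨ σn≡kn ⟨
    σ n                              ≡⟨ cong σ n≡Π ⟩
    σ (Π (_^ e) ps)                  ≡⟨ σ-Π e ps (All.map⁺ ps-prime) !ps ⟩
    Π (λ p → geomSum p (suc e)) ps   ∎
    where open ≡-Reasoning
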